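{- Let $G$ be an $n$-vertex graph with at least one edge, containing no subgraph isomorphic to $T$, such that $d(x)+d(y)\ge n+2$ for every edge $\{x,y\}$ of $G$. Then $G$ contains $K_4$ as a subgraph.
   Context: All graphs are finite, simple and undirected; $d(v)$ is the degree of $v$. $T$ is the graph on six vertices $a,b,c,d,e,f$ with edges $bc, ce, eb, ab, ac, bd, de, cf, fe$ (a triangle $bce$ with a triangle erected on each of its edges). -}

module Defs where

open import Data.Nat using (ℕ; _+_; _≥_)
open import Data.Fin using (Fin)
open import Data.Fin.Subset using (Subset; ∣_∣)
open import Data.Vec using (tabulate)
open import Data.Bool using (Bool; true; false)
open import Data.Product using (Σ; ∃; ∃-syntax; _×_; _,_)
open import Relation.Nullary using (¬_; Dec; does)
open import Relation.Binary.PropositionalEquality using (_≡_; _≢_)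
open import Function.Definitions using (Injective)
open import Level using (0ℓ)

record Graph (n : ℕ) : Set₁ where
  field
    Adj    : Fin n → Fin n → Set
    adj?   : ∀ x y → Dec (Adj x y)
    sym    : ∀ {x y} → Adj x y → Adj y x
    irrefl : ∀ {x} → ¬ Adj x x

open Graph public

nbhd : ∀ {n} (G : Graph n) → Fin n → Subset n
nbhd G x = tabulate (λ y → does (adj? G x y))

deg : ∀ {n} (G : Graph n) → Fin n → ℕ
deg G x = ∣ nbhd G x ∣

HasEdge : ∀ {n} → Graph n → Set
HasEdge {n} G = ∃[ x ] ∃[ y ] Adj G x y

EdgeDegCond : ∀ {n} → Graph n → Set
EdgeDegCond {n} G = ∀ x y → Adj G x y → deg G x + deg G y ≥ n + 2

-- The graph T on vertices a,b,c,d,e,f with edges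
-- bc, ce, eb, ab, ac, bd, de, cf, fe.
-- Encoding: a=0, b=1, c=2, d=3, e=4, f=5.
data TEdge : Fin 6 → Fin 6 → Set where
  bc : TEdge (Fin.suc Fin.zero) (Fin.suc (Fin.suc Fin.zero))
  ce : TEdge (Fin.suc (Fin.suc Fin.zero)) (Fin.suc (Fin.suc (Fin.suc (Fin.suc Fin.zero))))
  eb : TEdge (Fin.suc (Fin.suc (Fin.suc (Fin.suc Fin.zero)))) (Fin.suc Fin.zero)
  ab : TEdge Fin.zero (Fin.suc Fin.zero)
  ac : TEdge Fin.zero (Fin.suc (Fin.suc Fin.zero))
  bd : TEdge (Fin.suc Fin.zero) (Fin.suc (Fin.suc (Fin.suc Fin.zero)))
  de : TEdge (Fin.suc (Fin.suc (Fin.suc Fin.zero))) (Fin.suc (Fin.suc (Fin.suc (Fin.suc Fin.zero))))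
  cf : TEdge (Fin.suc (Fin.suc Fin.zero)) (Fin.suc (Fin.suc (Fin.suc (Fin.suc (Fin.suc Fin.zero)))))
  fe : TEdge (Fin.suc (Fin.suc (Fin.suc (Fin.suc (Fin.suc Fin.zero))))) (Fin.suc (Fin.suc (Fin.suc (Fin.suc Fin.zero))))

ContainsT : ∀ {n} → Graph n → Set
ContainsT {n} G = Σ (Fin 6 → Fin n) λ φ →
  Injective _≡_ _≡_ φ × (∀ u v → TEdge u v → Adj G (φ u) (φ v))

ContainsK4 : ∀ {n} → Graph n → Set
ContainsK4 {n} G = Σ (Fin 4 → Fin n) λ φ →
  Injective _≡_ _≡_ φ × (∀ u v → u ≢ v → Adj G (φ u) (φ v))

module Submission where

-- Every edge of G lies in at least two triangles: for an edge xy, counting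
-- shows |N(x) ∩ N(y)| ≥ d(x) + d(y) − n ≥ 2.  Starting from any edge xy this
-- gives a triangle xyz, and then outer vertices w, u, v with
--   w ∈ N(x) ∩ N(y), w ≠ z;   u ∈ N(x) ∩ N(z), u ≠ y;   v ∈ N(y) ∩ N(z), v ≠ x.
-- If two of w, u, v coincide, that vertex together with x, y, z spans a K4;
-- otherwise x, y, z with the three erected triangles form a copy of T.

open import Data.Nat using (ℕ; suc; _+_; _≤_; z≤n; s≤s)
open import Data.Nat.Properties
  using (+-suc; +-monoˡ-≤; +-cancelˡ-≤; ≤-trans; module ≤-Reasoning)
open import Data.Fin using (Fin; zero; suc; _≟_)
open import Data.Fin.Subset
  using (Subset; ∣_∣; _∈_; _∩_; _∪_; inside; outside; Nonempty)
open import Data.Fin.Subset.Properties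
  using (∣p∣≤n; x∈p∩q⁻; nonempty?; Empty-unique; ∣⊥∣≡0)
open import Data.Vec using (Vec; []; _∷_; lookup; here; there)
open import Data.Vec.Properties using ([]=⇒lookup; lookup∘tabulate)
open import Data.Vec.Relation.Unary.All using ([]; _∷_)
open import Data.Vec.Relation.Unary.All.Properties using (lookup⁺)
open import Data.Vec.Relation.Unary.AllPairs as AllPairs using (AllPairs; []; _∷_)
open import Data.Vec.Relation.Unary.Unique.Propositional using (Unique)
open import Data.Vec.Relation.Unary.Unique.Propositional.Properties using (lookup-injective)
open import Data.Product using (∃-syntax; _×_; _,_)
open import Data.Sum using (_⊎_; inj₁; inj₂)
open import Data.Empty using (⊥-elim)
open import Relation.Binary.Core using (Rel)
open import Relation.Binary.Definitions using (Symmetric)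
open import Relation.Nullary using (¬_; yes; no)
open import Relation.Binary.PropositionalEquality
  using (_≡_; _≢_; ≢-sym; refl; cong; subst; trans; module ≡-Reasoning)
  renaming (sym to ≡-sym)
open import Defs

∣p∪q∣+∣p∩q∣≡∣p∣+∣q∣ : ∀ {n} (p q : Subset n) → ∣ p ∪ q ∣ + ∣ p ∩ q ∣ ≡ ∣ p ∣ + ∣ q ∣
∣p∪q∣+∣p∩q∣≡∣p∣+∣q∣ [] [] = refl
∣p∪q∣+∣p∩q∣≡∣p∣+∣q∣ (inside ∷ p) (inside ∷ q) = cong suc (begin
  ∣ p ∪ q ∣ + suc ∣ p ∩ q ∣  ≡⟨ +-suc ∣ p ∪ q ∣ ∣ p ∩ q ∣ ⟩
  suc (∣ p ∪ q ∣ + ∣ p ∩ q ∣) ≡⟨ cong suc (∣p∪q∣+∣p∩q∣≡∣p∣+∣q∣ p q) ⟩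
  suc (∣ p ∣ + ∣ q ∣)         ≡⟨ ≡-sym (+-suc ∣ p ∣ ∣ q ∣) ⟩
  ∣ p ∣ + suc ∣ q ∣           ∎)
  where open ≡-Reasoning
∣p∪q∣+∣p∩q∣≡∣p∣+∣q∣ (inside ∷ p) (outside ∷ q) = cong suc (∣p∪q∣+∣p∩q∣≡∣p∣+∣q∣ p q)
∣p∪q∣+∣p∩q∣≡∣p∣+∣q∣ (outside ∷ p) (inside ∷ q) =
  trans (cong suc (∣p∪q∣+∣p∩q∣≡∣p∣+∣q∣ p q)) (≡-sym (+-suc ∣ p ∣ ∣ q ∣))
∣p∪q∣+∣p∩q∣≡∣p∣+∣q∣ (outside ∷ p) (outside ∷ q) = ∣p∪q∣+∣p∩q∣≡∣p∣+∣q∣ p q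

∣p∣+∣q∣≤n+∣p∩q∣ : ∀ {n} (p q : Subset n) → ∣ p ∣ + ∣ q ∣ ≤ n + ∣ p ∩ q ∣
∣p∣+∣q∣≤n+∣p∩q∣ {n} p q = begin
  ∣ p ∣ + ∣ q ∣              ≡⟨ ≡-sym (∣p∪q∣+∣p∩q∣≡∣p∣+∣q∣ p q) ⟩
  ∣ p ∪ q ∣ + ∣ p ∩ q ∣      ≤⟨ +-monoˡ-≤ ∣ p ∩ q ∣ (∣p∣≤n (p ∪ q)) ⟩
  n + ∣ p ∩ q ∣              ∎
  where open ≤-Reasoning

∣p∣≥1⇒nonempty : ∀ {n} (p : Subset n) → 1 ≤ ∣ p ∣ → Nonempty p
∣p∣≥1⇒nonempty {n} p 1≤∣p∣ with nonempty? p
... | yes p≠∅ = p≠∅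
... | no p=∅ with () ← subst (1 ≤_) (∣⊥∣≡0 n) (subst (λ r → 1 ≤ ∣ r ∣) (Empty-unique p=∅) 1≤∣p∣)

∣p∣≥2⇒∈-avoiding : ∀ {n} (p : Subset n) (z : Fin n) → 2 ≤ ∣ p ∣ → ∃[ w ] (w ≢ z × w ∈ p)
∣p∣≥2⇒∈-avoiding (inside ∷ p) zero (s≤s 1≤∣p∣) with (w , w∈p) ← ∣p∣≥1⇒nonempty p 1≤∣p∣ =
  suc w , (λ ()) , there w∈p
∣p∣≥2⇒∈-avoiding (outside ∷ p) zero 2≤∣p∣ with (w , w∈p) ← ∣p∣≥1⇒nonempty p (≤-trans (s≤s z≤n) 2≤∣p∣) =
  suc w , (λ ()) , there w∈p
∣p∣≥2⇒∈-avoiding (inside ∷ p) (suc z) _ = zero , (λ ()) , here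
∣p∣≥2⇒∈-avoiding (outside ∷ p) (suc z) 2≤∣p∣ with (w , w≢z , w∈p) ← ∣p∣≥2⇒∈-avoiding p z 2≤∣p∣ =
  suc w , (λ { refl → w≢z refl }) , there w∈p

∈nbhd⇒Adj : ∀ {n} (G : Graph n) {x y} → y ∈ nbhd G x → Adj G x y
∈nbhd⇒Adj G {x} {y} y∈N[x] with adj? G x y | trans (≡-sym (lookup∘tabulate _ y)) ([]=⇒lookup y∈N[x])
... | yes x~y | _ = x~y
... | no _    | ()

Adj⇒≢ : ∀ {n} (G : Graph n) {x y} → Adj G x y → x ≢ y
Adj⇒≢ G x~y refl = irrefl G x~y

commonNbhd : ∀ {n} → Graph n → Fin n → Fin n → Subset n
commonNbhd G x y = nbhd G x ∩ nbhd G y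

∣commonNbhd∣≥2 : ∀ {n} (G : Graph n) → EdgeDegCond G → ∀ {x y} → Adj G x y →
  2 ≤ ∣ commonNbhd G x y ∣
∣commonNbhd∣≥2 {n} G ore {x} {y} x~y = +-cancelˡ-≤ n 2 _ (begin
  n + 2                        ≤⟨ ore x y x~y ⟩
  deg G x + deg G y            ≤⟨ ∣p∣+∣q∣≤n+∣p∩q∣ (nbhd G x) (nbhd G y) ⟩
  n + ∣ commonNbhd G x y ∣     ∎)
  where open ≤-Reasoning

commonNeighbour-avoiding : ∀ {n} (G : Graph n) → EdgeDegCond G → ∀ {x y} → Adj G x y →
  (z : Fin n) → ∃[ w ] (w ≢ z × Adj G x w × Adj G y w)
commonNeighbour-avoiding G ore {x} {y} x~y z
  with (w , w≢z , w∈N) ← ∣p∣≥2⇒∈-avoiding (commonNbhd G x y) z (∣commonNbhd∣≥2 G ore x~y)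
  with (w∈N[x] , w∈N[y]) ← x∈p∩q⁻ (nbhd G x) (nbhd G y) w∈N =
  w , w≢z , ∈nbhd⇒Adj G w∈N[x] , ∈nbhd⇒Adj G w∈N[y]

AllPairs-lookup : ∀ {a ℓ} {A : Set a} {R : Rel A ℓ} → Symmetric R →
  ∀ {k} {xs : Vec A k} → AllPairs R xs → ∀ i j → i ≢ j → R (lookup xs i) (lookup xs j)
AllPairs-lookup R-sym (rx ∷ rxs) zero    zero    i≢j   = ⊥-elim (i≢j refl)
AllPairs-lookup R-sym (rx ∷ rxs) zero    (suc j) _     = lookup⁺ rx j
AllPairs-lookup R-sym (rx ∷ rxs) (suc i) zero    _     = R-sym (lookup⁺ rx i)
AllPairs-lookup R-sym (rx ∷ rxs) (suc i) (suc j) si≢sj =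
  AllPairs-lookup R-sym rxs i j (λ i≡j → si≢sj (cong suc i≡j))

clique⇒K4 : ∀ {n} (G : Graph n) (vs : Vec (Fin n) 4) → AllPairs (Adj G) vs → ContainsK4 G
clique⇒K4 G vs clique =
  lookup vs , (λ {i} {j} → lookup-injective distinct i j) , AllPairs-lookup (sym G) clique
  where
  distinct : Unique vs
  distinct = AllPairs.map (Adj⇒≢ G) clique

triangleWithApex⇒K4 : ∀ {n} (G : Graph n) {x y z t : Fin n} →
  Adj G x y → Adj G x z → Adj G y z → Adj G x t → Adj G y t → Adj G z t → ContainsK4 G
triangleWithApex⇒K4 G {x} {y} {z} {t} x~y x~z y~z x~t y~t z~t = clique⇒K4 G (x ∷ y ∷ z ∷ t ∷ [])
  ((x~y ∷ x~z ∷ x~t ∷ []) ∷ (y~z ∷ y~t ∷ []) ∷ (z~t ∷ []) ∷ [] ∷ [])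

-- The configuration forced by the degree condition: a triangle xyz together
-- with apexes w, u, v of triangles erected on xy, xz, yz.  If two apexes
-- coincide, that vertex and x, y, z span a K4; otherwise the six vertices,
-- read as a, b, c, d, e, f = w, x, y, u, z, v, form a copy of T.
erectedTriangles⇒K4⊎T : ∀ {n} (G : Graph n) {x y z w u v : Fin n} →
  Adj G x y → Adj G x z → Adj G y z →
  w ≢ z → Adj G x w → Adj G y w →
  u ≢ y → Adj G x u → Adj G z u →
  v ≢ x → Adj G y v → Adj G z v →
  ContainsK4 G ⊎ ContainsT G
erectedTriangles⇒K4⊎T G {x} {y} {z} {w} {u} {v}
  x~y x~z y~z w≢z x~w y~w u≢y x~u z~u v≢x y~v z~v with w ≟ u | w ≟ v | u ≟ v
... | yes refl | _        | _        = inj₁ (triangleWithApex⇒K4 G x~y x~z y~z x~w y~w z~u)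
... | no _     | yes refl | _        = inj₁ (triangleWithApex⇒K4 G x~y x~z y~z x~w y~w z~v)
... | no _     | no _     | yes refl = inj₁ (triangleWithApex⇒K4 G x~y x~z y~z x~u y~v z~u)
... | no w≢u   | no w≢v   | no u≢v   = inj₂ (lookup vs , (λ {i} {j} → lookup-injective distinct i j) , edges)
  where
  vs : Vec (Fin _) 6
  vs = w ∷ x ∷ y ∷ u ∷ z ∷ v ∷ []

  distinct : Unique vs
  distinct =
      (Adj⇒≢ G (sym G x~w) ∷ Adj⇒≢ G (sym G y~w) ∷ w≢u ∷ w≢z ∷ w≢v ∷ [])
    ∷ (Adj⇒≢ G x~y ∷ Adj⇒≢ G x~u ∷ Adj⇒≢ G x~z ∷ ≢-sym v≢x ∷ [])
    ∷ (≢-sym u≢y ∷ Adj⇒≢ G y~z ∷ Adj⇒≢ G y~v ∷ [])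
    ∷ (Adj⇒≢ G (sym G z~u) ∷ u≢v ∷ [])
    ∷ (Adj⇒≢ G z~v ∷ [])
    ∷ [] ∷ []

  edges : ∀ s t → TEdge s t → Adj G (lookup vs s) (lookup vs t)
  edges _ _ bc = x~y
  edges _ _ ce = y~z
  edges _ _ eb = sym G x~z
  edges _ _ ab = sym G x~w
  edges _ _ ac = sym G y~w
  edges _ _ bd = x~u
  edges _ _ de = sym G z~u
  edges _ _ cf = y~v
  edges _ _ fe = sym G z~v

lemma1 : ∀ (n : ℕ) (G : Graph n) → HasEdge G → ¬ ContainsT G →
    EdgeDegCond G → ContainsK4 G
lemma1 n G (x , y , x~y) noT ore
  with (z , _ , x~z , y~z) ← commonNeighbour-avoiding G ore x~y x
  with (w , w≢z , x~w , y~w) ← commonNeighbour-avoiding G ore x~y z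
  with (u , u≢y , x~u , z~u) ← commonNeighbour-avoiding G ore x~z y
  with (v , v≢x , y~v , z~v) ← commonNeighbour-avoiding G ore y~z x
  with erectedTriangles⇒K4⊎T G x~y x~z y~z w≢z x~w y~w u≢y x~u z~u v≢x y~v z~v
... | inj₁ K4 = K4
... | inj₂ T  = ⊥-elim (noT T)
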